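{- Let $A=\begin{pmatrix} a & b\\ c & d\end{pmatrix}\in \mathrm{SL}_2(\mathbb{Z})$ with $A\equiv\begin{pmatrix} 1 & 0\\ 0 & 1\end{pmatrix}\pmod 2$ and $c>0$, let $m\in\mathbb{Z}$ and $T^{2m}=\begin{pmatrix} 1 & 2m\\ 0 & 1\end{pmatrix}$. Then $\epsilon_1(AT^{2m})=\epsilon_1(A)\,e^{\pi i m/2}$.
   Context: For integers $h,k$ with $k>0$ and $\gcd(h,k)=1$, the Dedekind sum is $s(h,k)=\sum_{r=1}^{k-1}\frac{r}{k}\left(\frac{hr}{k}-\left\lfloor\frac{hr}{k}\right\rfloor-\frac12\right)$. For a matrix $M=\begin{pmatrix} \alpha & \beta\\ \gamma & \delta\end{pmatrix}\in\mathrm{SL}_2(\mathbb{Z})$ with $\gamma>0$, define $\epsilon_1(M)=e^{ -3\pi i/4}\exp\!\left(3\pi i\left(\frac{\alpha+\delta}{12\gamma}-s(\delta,\gamma)\right)\right)$. -}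

module Defs where

open import Data.Nat as ℕ using (ℕ; zero; suc)
open import Data.Integer as ℤ using (ℤ; +_)
open import Data.Rational as ℚ using (ℚ; _+_; _-_; _*_; _/_; floor; 0ℚ; 1ℚ)
open import Data.List using (List; map; foldr; upTo; drop)
open import Data.Product using (∃)
open import Relation.Binary.PropositionalEquality using (_≡_)

Σℚ : List ℚ → ℚ
Σℚ = foldr _+_ 0ℚ

ι : ℤ → ℚ
ι z = z / 1

½ : ℚ
½ = + 1 / 2

-- Dedekind sum s(h,k) = Σ_{r=1}^{k-1} (r/k) (hr/k - ⌊hr/k⌋ - 1/2), for k > 0.
-- (k = 0 is never used; it is given the junk value 0.)
dedekind : ℤ → ℕ → ℚ
dedekind h zero = 0ℚ
dedekind h (suc k') =
  Σℚ (map (λ r → (+ r / k) * ((h ℤ.* + r) / k - ι (floor ((h ℤ.* + r) / k)) - ½))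
          (drop 1 (upTo k)))
  where k = suc k'

-- Unit complex numbers of the form e^{π i x}, x ∈ ℚ, are represented by
-- their exponent x ("phase"): the number e^{π i x} is represented by x.
-- Two phases represent the same complex number iff they differ by an even integer.
_≈ᵖ_ : ℚ → ℚ → Set
x ≈ᵖ y = ∃ λ (k : ℤ) → x - y ≡ ι (+ 2 ℤ.* k)

-- Phase (exponent x with ε₁(M) = e^{π i x}) of
-- ε₁(M) = e^{-3πi/4} exp(3πi((α+δ)/(12γ) - s(δ,γ))),
-- for M = (α β; γ δ) with γ > 0 (γ ≤ 0: junk value).
ε₁ᵖ : ℤ → ℤ → ℤ → ℤ → ℚ
ε₁ᵖ α β (+ zero) δ = 0ℚ
ε₁ᵖ α β (+ suc g') δ =
  ℚ.- (+ 3 / 4) + ι (+ 3) * ((α ℤ.+ δ) / (12 ℕ.* g) - dedekind δ g)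
  where g = suc g'
ε₁ᵖ α β ℤ.-[1+ n ] δ = 0ℚ

-- Right multiplication by T^{2m} changes the lower row (γ, δ) of A only to (γ, δ + 2mγ). The Dedekind
-- sum s(δ, γ) sees δ only through the fractional parts of δr/γ, so it is unchanged, and the phase of ε₁
-- moves by exactly 3 · 2mγ/(12γ) = m/2.
module Submission where

open import Defs
open import Data.Integer using (ℤ; +_; _+_; _-_; _*_; _>_; 1ℤ)
open import Data.Integer.Divisibility using (_∣_)
open import Data.Rational using (_/_)
import Data.Rational as ℚ
open import Relation.Binary.PropositionalEquality using (_≡_)

open import Data.Nat as ℕ using (suc)
open import Data.Nat.GCD using (gcd; gcd[m,n]≢0)
open import Data.Nat.Properties using (*-monoˡ-<)
open import Data.Integer as ℤ using (0ℤ; +<+; _/ℕ_; _%ℕ_)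
open import Data.Integer.Properties
  using ( +-injective; ≤-antisym; ≤-<-trans; i≤j+i; +-monoˡ-<; suc-*; pred-suc; pos-*
        ; *-cancelʳ-<-nonNeg; i<j⇒i≤pred[j])
open import Data.Integer.DivMod
  using (a≡a%ℕn+[a/ℕn]*n; n%ℕd<d; [n/ℕd]*d≤n; n<s[n/ℕd]*d; div-pos-is-/ℕ)
open import Data.Integer.Tactic.RingSolver using (solve-∀)
open import Data.Rational using (ℚ; ↥_; ↧_; ↧ₙ_; floor; fromℚᵘ)
open import Data.Rational.Properties
  using ( toℚᵘ-injective; toℚᵘ-fromℚᵘ; toℚᵘ-homo-+; toℚᵘ-homo-*; fromℚᵘ-cong
        ; ↥-/; ↧-/; ↥p/↧p≡p; +-inverseʳ)
import Data.Rational.Unnormalised as ℚᵘ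
import Data.Rational.Unnormalised.Properties as ℚᵘ
open import Data.Rational.Solver using (module +-*-Solver)
open import Data.List using (upTo; drop)
open import Data.List.Properties using (map-cong)
open import Data.Product using (_,_)
open import Data.Sum using (inj₂)
open import Function using (_∘_)
open import Relation.Binary.PropositionalEquality
  using (refl; sym; trans; cong; cong₂; subst; module ≡-Reasoning)
open ≡-Reasoning

/ℕ-unique : ∀ n d .{{_ : ℕ.NonZero d}} q r → r ℕ.< d → n ≡ + r + q * + d → n /ℕ d ≡ q
/ℕ-unique _ d q r r<d refl =
  ≤-antisym (quotient-≤ ([n/ℕd]*d≤n n d) n<[1+q]*d) (quotient-≤ (i≤j+i _ (+ r)) (n<s[n/ℕd]*d n d))
  where
  n = + r + q * + d
  quotient-≤ : ∀ {i j} → i * + d ℤ.≤ n → n ℤ.< ℤ.suc j * + d → i ℤ.≤ j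
  quotient-≤ {i} {j} i*d≤n n<[1+j]*d = subst (i ℤ.≤_) (pred-suc j)
    (i<j⇒i≤pred[j] {j = ℤ.suc j} (*-cancelʳ-<-nonNeg (+ d) (≤-<-trans i*d≤n n<[1+j]*d)))
  n<[1+q]*d : n ℤ.< ℤ.suc q * + d
  n<[1+q]*d = subst (n ℤ.<_) (sym (suc-* q (+ d))) (+-monoˡ-< (q * + d) (+<+ r<d))

[n+kd]/ℕd≡n/ℕd+k : ∀ n k d .{{_ : ℕ.NonZero d}} → (n + k * + d) /ℕ d ≡ n /ℕ d + k
[n+kd]/ℕd≡n/ℕd+k n k d = /ℕ-unique _ d _ (n %ℕ d) (n%ℕd<d n d) (begin
  n + k * + d                          ≡⟨ cong (_+ k * + d) (a≡a%ℕn+[a/ℕn]*n n d) ⟩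
  + (n %ℕ d) + n /ℕ d * + d + k * + d  ≡⟨ regroup (+ (n %ℕ d)) (n /ℕ d) k (+ d) ⟩
  + (n %ℕ d) + (n /ℕ d + k) * + d      ∎)
  where
  regroup : ∀ r q k d → r + q * d + k * d ≡ r + (q + k) * d
  regroup = solve-∀

floor≡↥/ℕ↧ₙ : ∀ p → floor p ≡ ↥ p /ℕ ↧ₙ p
floor≡↥/ℕ↧ₙ (ℚ.mkℚ n d _) = div-pos-is-/ℕ n (suc d)

-- i / k is stored in lowest terms ↥ p / ↧ p, with i = ↥ p · g and k = ↧ p · g for g = gcd(i, k);
-- scaling the division of ↥ p by ↧ p by g gives the division of i by k.
floor-/ : ∀ i k .{{_ : ℕ.NonZero k}} → floor (i / k) ≡ i /ℕ k
floor-/ i k = trans (floor≡↥/ℕ↧ₙ p) (sym (/ℕ-unique i k q (r ℕ.* g) rg<k (begin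
  i                                ≡⟨ ↥-/ i k ⟨
  ↥ p * + g                        ≡⟨ cong (_* + g) (a≡a%ℕn+[a/ℕn]*n (↥ p) (↧ₙ p)) ⟩
  (+ r + q * ↧ p) * + g            ≡⟨ distrib (+ r) q (↧ p) (+ g) ⟩
  + r * + g + q * (↧ p * + g)      ≡⟨ cong₂ (λ x y → x + q * y) (sym (pos-* r g)) (↧-/ i k) ⟩
  + (r ℕ.* g) + q * + k            ∎)))
  where
  p = i / k
  q = ↥ p /ℕ ↧ₙ p
  r = ↥ p %ℕ ↧ₙ p
  g = gcd ℤ.∣ i ∣ k
  instance
    g≢0 : ℕ.NonZero g
    g≢0 = ℕ.≢-nonZero (gcd[m,n]≢0 ℤ.∣ i ∣ k (inj₂ (ℕ.≢-nonZero⁻¹ k)))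
  rg<k : r ℕ.* g ℕ.< k
  rg<k = subst (r ℕ.* g ℕ.<_) (+-injective (trans (pos-* (↧ₙ p) g) (↧-/ i k)))
               (*-monoˡ-< g (n%ℕd<d (↥ p) (↧ₙ p)))
  distrib : ∀ r q d g → (r + q * d) * g ≡ r * g + q * (d * g)
  distrib = solve-∀

fromℚᵘ-homo-+ : ∀ p q → fromℚᵘ (p ℚᵘ.+ q) ≡ fromℚᵘ p ℚ.+ fromℚᵘ q
fromℚᵘ-homo-+ p q = toℚᵘ-injective (ℚᵘ.≃-trans (toℚᵘ-fromℚᵘ (p ℚᵘ.+ q)) (ℚᵘ.≃-sym
  (ℚᵘ.≃-trans (toℚᵘ-homo-+ (fromℚᵘ p) (fromℚᵘ q)) (ℚᵘ.+-cong (toℚᵘ-fromℚᵘ p) (toℚᵘ-fromℚᵘ q)))))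

fromℚᵘ-homo-* : ∀ p q → fromℚᵘ (p ℚᵘ.* q) ≡ fromℚᵘ p ℚ.* fromℚᵘ q
fromℚᵘ-homo-* p q = toℚᵘ-injective (ℚᵘ.≃-trans (toℚᵘ-fromℚᵘ (p ℚᵘ.* q)) (ℚᵘ.≃-sym
  (ℚᵘ.≃-trans (toℚᵘ-homo-* (fromℚᵘ p) (fromℚᵘ q)) (ℚᵘ.*-cong (toℚᵘ-fromℚᵘ p) (toℚᵘ-fromℚᵘ q)))))

/-distribʳ-+ : ∀ i j n .{{_ : ℕ.NonZero n}} → (i + j) / n ≡ i / n ℚ.+ j / n
/-distribʳ-+ i j (suc n) = trans
  (fromℚᵘ-cong {ℚᵘ.mkℚᵘ (i + j) n} {ℚᵘ.mkℚᵘ i n ℚᵘ.+ ℚᵘ.mkℚᵘ j n} (ℚᵘ.*≡* (cross i j (+ suc n))))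
  (fromℚᵘ-homo-+ (ℚᵘ.mkℚᵘ i n) (ℚᵘ.mkℚᵘ j n))
  where
  cross : ∀ i j d → (i + j) * (d * d) ≡ (i * d + j * d) * d
  cross = solve-∀

[k*n]/n≡k : ∀ k n .{{_ : ℕ.NonZero n}} → (k * + n) / n ≡ ι k
[k*n]/n≡k k (suc n) = fromℚᵘ-cong {ℚᵘ.mkℚᵘ (k * + suc n) n} {ℚᵘ.mkℚᵘ k 0} (ℚᵘ.*≡* (cancel k (+ suc n)))
  where
  cancel : ∀ k d → k * d * + 1 ≡ k * d
  cancel = solve-∀

[i+kn]/n≡i/n+k : ∀ i k n .{{_ : ℕ.NonZero n}} → (i + k * + n) / n ≡ i / n ℚ.+ ι k
[i+kn]/n≡i/n+k i k n = trans (/-distribʳ-+ i (k * + n) n) (cong (i / n ℚ.+_) ([k*n]/n≡k k n))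

floor-+-ι : ∀ p k → floor (p ℚ.+ ι k) ≡ floor p + k
floor-+-ι p k = begin
  floor (p ℚ.+ ι k)               ≡⟨ cong (λ x → floor (x ℚ.+ ι k)) (↥p/↧p≡p p) ⟨
  floor (↥ p / ↧ₙ p ℚ.+ ι k)      ≡⟨ cong floor ([i+kn]/n≡i/n+k (↥ p) k (↧ₙ p)) ⟨
  floor ((↥ p + k * ↧ p) / ↧ₙ p)  ≡⟨ floor-/ (↥ p + k * ↧ p) (↧ₙ p) ⟩
  (↥ p + k * ↧ p) /ℕ ↧ₙ p         ≡⟨ [n+kd]/ℕd≡n/ℕd+k (↥ p) k (↧ₙ p) ⟩
  ↥ p /ℕ ↧ₙ p + k                 ≡⟨ cong (_+ k) (floor≡↥/ℕ↧ₙ p) ⟨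
  floor p + k                     ∎

frac : ℚ → ℚ
frac p = p ℚ.- ι (floor p)

frac-+-ι : ∀ p k → frac (p ℚ.+ ι k) ≡ frac p
frac-+-ι p k = begin
  (p ℚ.+ ι k) ℚ.- ι (floor (p ℚ.+ ι k))  ≡⟨ cong (λ x → (p ℚ.+ ι k) ℚ.- ι x) (floor-+-ι p k) ⟩
  (p ℚ.+ ι k) ℚ.- ι (floor p + k)        ≡⟨ cong (λ x → (p ℚ.+ ι k) ℚ.- x) (/-distribʳ-+ (floor p) k 1) ⟩
  (p ℚ.+ ι k) ℚ.- (ι (floor p) ℚ.+ ι k)  ≡⟨ cancel p (ι k) (ι (floor p)) ⟩
  p ℚ.- ι (floor p)                      ∎
  where
  open +-*-Solver
  cancel : ∀ p x y → (p ℚ.+ x) ℚ.- (y ℚ.+ x) ≡ p ℚ.- y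
  cancel = solve 3 (λ p x y → (p :+ x) :- (y :+ x) := p :- y) refl

dedekind-periodic : ∀ h j k → dedekind (j * + k + h) k ≡ dedekind h k
dedekind-periodic h j ℕ.zero = refl
dedekind-periodic h j k@(suc _) = cong Σℚ (map-cong summand (drop 1 (upTo k)))
  where
  summand : ∀ r → + r / k ℚ.* (frac ((j * + k + h) * + r / k) ℚ.- ½)
                ≡ + r / k ℚ.* (frac (h * + r / k) ℚ.- ½)
  summand r = cong (λ x → + r / k ℚ.* (x ℚ.- ½)) (begin
    frac ((j * + k + h) * + r / k)        ≡⟨ cong (frac ∘ (_/ k)) (expand j (+ k) h (+ r)) ⟩
    frac ((h * + r + j * + r * + k) / k)  ≡⟨ cong frac ([i+kn]/n≡i/n+k (h * + r) (j * + r) k) ⟩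
    frac (h * + r / k ℚ.+ ι (j * + r))    ≡⟨ frac-+-ι (h * + r / k) (j * + r) ⟩
    frac (h * + r / k)                    ∎)
    where
    expand : ∀ j k h r → (j * k + h) * r ≡ h * r + j * r * k
    expand = solve-∀

3*[2mg/12g]≡m/2 : ∀ m g → ι (+ 3) ℚ.* ((+ 2 * m * + suc g) / (12 ℕ.* suc g)) ≡ m / 2
3*[2mg/12g]≡m/2 m g = begin
  fromℚᵘ three ℚ.* fromℚᵘ shift  ≡⟨ fromℚᵘ-homo-* three shift ⟨
  fromℚᵘ (three ℚᵘ.* shift)      ≡⟨ fromℚᵘ-cong {three ℚᵘ.* shift} {ℚᵘ.mkℚᵘ m 1} (ℚᵘ.*≡* (cross m (+ suc g))) ⟩
  m / 2                          ∎
  where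
  three = ℚᵘ.mkℚᵘ (+ 3) 0
  shift = ℚᵘ.mkℚᵘ (+ 2 * m * + suc g) (ℕ.pred (12 ℕ.* suc g))
  cross : ∀ m g → + 3 * (+ 2 * m * g) * + 2 ≡ m * (+ 1 * (+ 12 * g))
  cross = solve-∀

ε₁ᵖ-*T²ᵐ : ∀ α β β′ δ m {γ} → γ > + 0 → ε₁ᵖ α β′ γ (+ 2 * m * γ + δ) ≡ ε₁ᵖ α β γ δ ℚ.+ m / 2
ε₁ᵖ-*T²ᵐ α β β′ δ m {+ ℕ.zero} (+<+ ())
ε₁ᵖ-*T²ᵐ α β β′ δ m {+ suc g′} _ = begin
  c ℚ.+ t ℚ.* ((α + (j + δ)) / N ℚ.- dedekind (j + δ) g)
    ≡⟨ cong (λ s → c ℚ.+ t ℚ.* ((α + (j + δ)) / N ℚ.- s)) (dedekind-periodic δ (+ 2 * m) g) ⟩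
  c ℚ.+ t ℚ.* ((α + (j + δ)) / N ℚ.- S)
    ≡⟨ cong (λ x → c ℚ.+ t ℚ.* (x ℚ.- S)) (trans (cong (_/ N) (regroup α j δ)) (/-distribʳ-+ (α + δ) j N)) ⟩
  c ℚ.+ t ℚ.* (((α + δ) / N ℚ.+ j / N) ℚ.- S)
    ≡⟨ split c t ((α + δ) / N) (j / N) S ⟩
  (c ℚ.+ t ℚ.* ((α + δ) / N ℚ.- S)) ℚ.+ t ℚ.* (j / N)
    ≡⟨ cong (c ℚ.+ t ℚ.* ((α + δ) / N ℚ.- S) ℚ.+_) (3*[2mg/12g]≡m/2 m g′) ⟩
  (c ℚ.+ t ℚ.* ((α + δ) / N ℚ.- S)) ℚ.+ m / 2
    ∎
  where
  g = suc g′
  N = 12 ℕ.* g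
  j = + 2 * m * + g
  c = ℚ.- (+ 3 / 4)
  t = ι (+ 3)
  S = dedekind δ g
  regroup : ∀ α j δ → α + (j + δ) ≡ (α + δ) + j
  regroup = solve-∀
  split : ∀ c t x y s → c ℚ.+ t ℚ.* ((x ℚ.+ y) ℚ.- s) ≡ (c ℚ.+ t ℚ.* (x ℚ.- s)) ℚ.+ t ℚ.* y
  split = solve 5 (λ c t x y s → c :+ t :* ((x :+ y) :- s) := (c :+ t :* (x :- s)) :+ t :* y) refl
    where open +-*-Solver

≡⇒≈ᵖ : ∀ {x y} → x ≡ y → x ≈ᵖ y
≡⇒≈ᵖ {x} refl = 0ℤ , +-inverseʳ x

lemma3 : (a b c d : ℤ) → a * d - b * c ≡ 1ℤ →
    + 2 ∣ (a - 1ℤ) → + 2 ∣ b → + 2 ∣ c → + 2 ∣ (d - 1ℤ) →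
    c > + 0 → (m : ℤ) →
    ε₁ᵖ a (+ 2 * m * a + b) c (+ 2 * m * c + d)
    ≈ᵖ (ε₁ᵖ a b c d ℚ.+ (m / 2))
lemma3 a b c d _ _ _ _ _ c>0 m = ≡⇒≈ᵖ (ε₁ᵖ-*T²ᵐ a b (+ 2 * m * a + b) d m c>0)
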